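{- Let $\mathcal A$ be a countable alphabet with a degree map $\deg:\mathcal A\to\mathbb Z_{\ge1}$ such that only finitely many letters have each degree, and let $(\mathrm{Lie}(\mathcal A),[\cdot,\cdot],\triangleright)$ be a post-Lie algebra (with $[\cdot,\cdot]$ the usual bracket of the free Lie algebra) such that $\triangleright$ is homogeneous for the induced grading. Let $\circledast$ be the associated Grossman–Larson product on $\mathbb Q\langle\mathcal A\rangle$ and $\Delta_\circledast$ its dual coproduct. Then for every word $A\in\mathcal A^*$, \[ \Delta_\circledast(A)=\sum_{n\ge1}\ \sum_{A=A_1\cdots A_n}(A_1\otimes\mathbf 1)⧢_\bullet\triangleleft^{\mathrm{irr}}(A_2)⧢_\bullet\cdots⧢_\bullet\triangleleft^{\mathrm{irr}}(A_n), \] where the inner sum runs over all factorizations of $A$ into (possibly empty) subwords $A_1,\dots,A_n$.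
   Context: $\mathcal A^*$ is the set of words in $\mathcal A$ including the empty word $\mathbf 1$; $\mathbb Q\langle\mathcal A\rangle$ is the free associative algebra (concatenation) and $\mathrm{Lie}(\mathcal A)\subset\mathbb Q\langle\mathcal A\rangle$ the free Lie algebra, via $[u,w]=uw-wu$. $\mathbb Q\langle\mathcal A\rangle$ with concatenation and the shuffle coproduct $\Delta$ (multiplicative, $\Delta(a)=a\otimes\mathbf1+\mathbf1\otimes a$ for letters $a$; Sweedler notation $\Delta(A)=A_{(1)}\otimes A_{(2)}$) is the universal enveloping algebra of $\mathrm{Lie}(\mathcal A)$. A post-Lie algebra is a Lie algebra $(\mathfrak g,[\cdot,\cdot])$ with bilinear $\triangleright$ satisfying $x\triangleright[y,z]=[x\triangleright y,z]+[y,x\triangleright z]$ and $[x,y]\triangleright z=x\triangleright(y\triangleright z)-(x\triangleright y)\triangleright z-y\triangleright(x\triangleright z)+(y\triangleright x)\triangleright z$. The product $\triangleright$ extends uniquely to $\mathbb Q\langle\mathcal A\rangle\otimes\mathbb Q\langle\mathcal A\rangle\to\mathbb Q\langle\mathcal A\rangle$ by $x\triangleright\mathbf1=0$, $\mathbf1\triangleright A=A$, $xA\triangleright y=x\triangleright(A\triangleright y)-(x\triangleright A)\triangleright y$, $A\triangleright BC=(A_{(1)}\triangleright B)(A_{(2)}\triangleright C)$ ($x,y\in\mathrm{Lie}(\mathcal A)$). The Grossman–Larson product is $A\circledast B=A_{(1)}(A_{(2)}\triangleright B)$. The pairing $(-\mid-)$ on $\mathbb Q\langle\mathcal A\rangle$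 is the bilinear form for which words are orthonormal; $\Delta_\circledast$ is defined by $(A\circledast B\mid C)=(A\otimes B\mid\Delta_\circledast(C))$ and $\triangleleft$ by $(A\triangleright B\mid C)=(A\otimes B\mid\triangleleft(C))$. The reduced cotriangle map is $\triangleleft^{\mathrm{irr}}(A)=\sum_{w\in\mathcal A^*,\,a\in\mathcal A}(w\otimes a\mid\triangleleft(A))\,w\otimes a$. The shuffle product $⧢$ is given by $\mathbf1⧢A=A⧢\mathbf1=A$ and $xA⧢yB=x(A⧢yB)+y(xA⧢B)$ for letters $x,y$. Finally $(A_1\otimes A_2)⧢_\bullet(B_1\otimes B_2)=(A_1⧢B_1)\otimes(A_2B_2)$ on $\mathbb Q\langle\mathcal A\rangle^{\otimes2}$. -}

module Defs where

open import Data.Nat as ℕ using (ℕ; zero; suc; _≤_)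
open import Data.Rational using (ℚ; 0ℚ; 1ℚ; _+_; _*_; -_)
open import Data.List using (List; []; _∷_; _++_; map; concatMap; foldr; foldl; [_])
open import Data.List.Properties using (≡-dec)
open import Data.List.Membership.Propositional using (_∈_)
open import Data.Product using (Σ; _×_; _,_; proj₁; proj₂)
open import Relation.Binary.PropositionalEquality using (_≡_; _≢_; cong)
open import Relation.Binary.Definitions using (DecidableEquality)
open import Relation.Nullary using (yes; no; does)
open import Data.Bool using (if_then_else_)
open import Function.Definitions using (Injective)

-- A countable graded alphabet: letters of L are encoded injectively in ℕ,
-- deg : L → ℤ_{≥1}, and each degree has only finitely many letters
-- (all letters of degree d lie in some finite list).
record Alphabet : Set₁ where
  field
    L        : Set
    enc      : L → ℕ
    enc-inj  : Injective _≡_ _≡_ enc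
    deg      : L → ℕ
    deg≥1    : ∀ a → 1 ≤ deg a
    fin-deg  : ∀ d → Σ (List L) (λ ls → ∀ a → deg a ≡ d → a ∈ ls)

module Over (𝔸 : Alphabet) where
  open Alphabet 𝔸 public

  _≟L_ : DecidableEquality L
  a ≟L b with enc a ℕ.≟ enc b
  ... | yes p = yes (enc-inj p)
  ... | no ¬p = no (λ e → ¬p (cong enc e))

  Word : Set
  Word = List L

  _≟W_ : DecidableEquality Word
  _≟W_ = ≡-dec _≟L_

  degW : Word → ℕ
  degW = foldr (λ a n → deg a ℕ.+ n) 0

  -- ℚ⟨𝒜⟩ : finite formal ℚ-linear combinations of words,
  -- compared coefficientwise (words orthonormal for the pairing).
  Poly : Set
  Poly = List (ℚ × Word)

  sumℚ : List ℚ → ℚ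
  sumℚ = foldr _+_ 0ℚ

  coeff : Poly → Word → ℚ
  coeff [] W = 0ℚ
  coeff ((c , u) ∷ P) W = (if does (u ≟W W) then c else 0ℚ) + coeff P W

  infix 4 _≈_
  _≈_ : Poly → Poly → Set
  P ≈ Q = ∀ W → coeff P W ≡ coeff Q W

  mono : Word → Poly
  mono u = [ (1ℚ , u) ]

  𝟏 : Poly
  𝟏 = mono []

  𝟎 : Poly
  𝟎 = []

  infixl 6 _⊕_ _⊖_
  infixl 7 _·_ _•_
  _⊕_ : Poly → Poly → Poly
  P ⊕ Q = P ++ Q

  _•_ : ℚ → Poly → Poly
  c • P = map (λ { (d , u) → (c * d , u) }) P

  _⊖_ : Poly → Poly → Poly
  P ⊖ Q = P ⊕ ((- 1ℚ) • Q)

  _·_ : Poly → Poly → Poly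
  P · Q = concatMap (λ { (c , u) → map (λ { (d , v) → (c * d , u ++ v) }) Q }) P

  ⟦_,_⟧ : Poly → Poly → Poly
  ⟦ P , Q ⟧ = P · Q ⊖ Q · P

  data IsLie : Poly → Set where
    lie-letter : ∀ a → IsLie (mono [ a ])
    lie-zero   : IsLie 𝟎
    lie-add    : ∀ {P Q} → IsLie P → IsLie Q → IsLie (P ⊕ Q)
    lie-scale  : ∀ c {P} → IsLie P → IsLie (c • P)
    lie-br     : ∀ {P Q} → IsLie P → IsLie Q → IsLie ⟦ P , Q ⟧
    lie-resp   : ∀ {P Q} → P ≈ Q → IsLie P → IsLie Q

  Homogeneous : ℕ → Poly → Set
  Homogeneous d P = ∀ W → coeff P W ≢ 0ℚ → degW W ≡ d

  -- ℚ⟨𝒜⟩ ⊗ ℚ⟨𝒜⟩ as finite combinations of pairs of words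
  Poly2 : Set
  Poly2 = List (ℚ × Word × Word)

  -- shuffle coproduct on words, multiplicative with Δ(a) = a⊗1 + 1⊗a:
  -- Δ(a w) = (a⊗1 + 1⊗a) Δ(w)
  Δw : Word → Poly2
  Δw [] = [ (1ℚ , [] , []) ]
  Δw (a ∷ w) = map (λ { (c , u , v) → (c , a ∷ u , v) }) (Δw w)
            ++ map (λ { (c , u , v) → (c , u , a ∷ v) }) (Δw w)

  Δ : Poly → Poly2
  Δ P = concatMap (λ { (c , w) → map (λ { (d , u , v) → (c * d , u , v) }) (Δw w) }) P

  -- A bilinear product on ℚ⟨𝒜⟩ given by its values on pairs of words
  Prod : Set
  Prod = Word → Word → Poly

  ext : Prod → Poly → Poly → Poly
  ext t P Q = concatMap (λ { (c , u) → concatMap (λ { (d , v) → (c * d) • t u v }) Q }) P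

  sweedler : Prod → Poly → Poly → Poly → Poly
  sweedler t A B C =
    concatMap (λ { (c , u₁ , u₂) → c • (ext t (mono u₁) B · ext t (mono u₂) C) }) (Δ A)

  -- t is the (unique) extension to ℚ⟨𝒜⟩ of a homogeneous post-Lie product
  -- ▷ on (Lie(𝒜), [·,·])
  record PostLieExt (t : Prod) : Set where
    private
      _▷_ : Poly → Poly → Poly
      _▷_ = ext t
    field
      closed : ∀ {x y} → IsLie x → IsLie y → IsLie (x ▷ y)
      derivation : ∀ {x y z} → IsLie x → IsLie y → IsLie z →
        x ▷ ⟦ y , z ⟧ ≈ ⟦ x ▷ y , z ⟧ ⊕ ⟦ y , x ▷ z ⟧
      postLie : ∀ {x y z} → IsLie x → IsLie y → IsLie z →
        ⟦ x , y ⟧ ▷ z ≈ x ▷ (y ▷ z) ⊖ (x ▷ y) ▷ z ⊖ y ▷ (x ▷ z) ⊕ (y ▷ x) ▷ z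
      homogeneous : ∀ {x y} p q → IsLie x → IsLie y →
        Homogeneous p x → Homogeneous q y → Homogeneous (p ℕ.+ q) (x ▷ y)
      ext-unit-r : ∀ {x} → IsLie x → x ▷ 𝟏 ≈ 𝟎
      ext-unit-l : ∀ A → 𝟏 ▷ A ≈ A
      ext-left   : ∀ {x y} A → IsLie x → IsLie y →
        (x · A) ▷ y ≈ x ▷ (A ▷ y) ⊖ (x ▷ A) ▷ y
      ext-right  : ∀ A B C → A ▷ (B · C) ≈ sweedler t A B C

  GL : Prod → Poly → Poly → Poly
  GL t A B = concatMap (λ { (c , u₁ , u₂) → c • (mono u₁ · ext t (mono u₂) B) }) (Δ A)

  -- (U ⊗ V | Δ_⊛(A)) := (U ⊛ V | A)
  ΔGL-coeff : Prod → Word → Word → Word → ℚ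
  ΔGL-coeff t A U V = coeff (GL t (mono U) (mono V)) A

  -- Elements of (a completion of) ℚ⟨𝒜⟩⊗ℚ⟨𝒜⟩ given by coefficient functions
  -- X U V = (U ⊗ V | X).
  Coef2 : Set
  Coef2 = Word → Word → ℚ

  tensor1 : Word → Coef2
  tensor1 A₁ U V =
    if does (U ≟W A₁) then (if does (V ≟W []) then 1ℚ else 0ℚ) else 0ℚ

  -- ◁^irr(A) = Σ_{w, a} (w ▷ a | A) w ⊗ a
  irr : Prod → Word → Coef2
  irr t A w (a ∷ []) = coeff (ext t (mono w) (mono [ a ])) A
  irr t A w _        = 0ℚ

  -- deshuffles: (U | U₁ ⧢ U₂) = multiplicity of (U₁ , U₂) in desh U
  desh : Word → List (Word × Word)
  desh [] = [ ([] , []) ]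
  desh (a ∷ w) = map (λ { (u , v) → (a ∷ u , v) }) (desh w)
              ++ map (λ { (u , v) → (u , a ∷ v) }) (desh w)

  splits : Word → List (Word × Word)
  splits [] = [ ([] , []) ]
  splits (a ∷ w) = ([] , a ∷ w) ∷ map (λ { (u , v) → (a ∷ u , v) }) (splits w)

  -- (A₁ ⊗ A₂) ⧢• (B₁ ⊗ B₂) = (A₁ ⧢ B₁) ⊗ (A₂ B₂), coefficientwise
  _⧢•_ : Coef2 → Coef2 → Coef2
  (X ⧢• Y) U V =
    sumℚ (concatMap (λ { (U₁ , U₂) →
      map (λ { (V₁ , V₂) → X U₁ V₁ * Y U₂ V₂ }) (splits V) }) (desh U))

  facts : ℕ → Word → List (List Word)
  facts zero A = []
  facts (suc zero) A = [ [ A ] ]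
  facts (suc (suc n)) A = concatMap (λ PS → map (proj₁ PS ∷_) (facts (suc n) (proj₂ PS))) (splits A)

  factorTerm : Prod → List Word → Coef2
  factorTerm t [] = λ _ _ → 0ℚ
  factorTerm t (A₁ ∷ As) = foldl (λ acc Aᵢ → acc ⧢• irr t Aᵢ) (tensor1 A₁) As

  term : Prod → ℕ → Word → Coef2
  term t n A U V = sumℚ (map (λ fs → factorTerm t fs U V) (facts n A))

  partialRHS : Prod → ℕ → Word → Coef2
  partialRHS t zero A U V = 0ℚ
  partialRHS t (suc N) A U V = partialRHS t N A U V + term t (suc N) A U V

-- Pairing with U ⊗ V, the coefficient of Δ_⊛(A) is (U ⊛ V | A) = Σ (U₍₁₎ | A₁)(U₍₂₎ ▷ V | A₂)
-- over A = A₁A₂, i.e. Δ_⊛(A) = Σ (A₁ ⊗ 𝟏) ⧢• ◁(A₂). Split ◁ = Σₘ ◁ₘ by the length m of the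
-- right tensor factor. Then ◁₀(A) = ε(A) 𝟏 ⊗ 𝟏 (since u ▷ 𝟏 = ε(u) 𝟏, which follows from
-- ext-right and 𝟏 ▷ 𝟏 = 𝟏), ◁₁ = ◁^irr, and dually to A ▷ bC = (A₍₁₎ ▷ b)(A₍₂₎ ▷ C),
-- ◁ₘ₊₁(A) = Σ_{A = A₁A₂} ◁^irr(A₁) ⧢• ◁ₘ(A₂) for m ≥ 1. By associativity of ⧢•, the n-th
-- summand of the right-hand side is Σ (A₁ ⊗ 𝟏) ⧢• ◁ₙ₋₁(A₂), so the partial sums agree with
-- Δ_⊛(A) at U ⊗ V as soon as n exceeds the length of V.

module Submission where

open import Defs
open import Algebra.Bundles using (CommutativeMonoid)
open import Data.Bool using (true; false; if_then_else_)
open import Data.List using (List; []; _∷_; _++_; [_]; map; concatMap; foldr; foldl; length)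
open import Data.List.Properties using (++-identityʳ)
open import Data.Nat as ℕ using (ℕ; zero; suc; _≤_; _<_; z≤n; s≤s)
import Data.Nat.Properties as ℕ
open import Data.Product using (Σ; _×_; _,_; uncurry)
open import Data.Sum using (inj₁; inj₂)
open import Data.Rational using (ℚ; 0ℚ; 1ℚ; _+_; _*_)
open import Data.Rational.Properties
open import Relation.Binary.PropositionalEquality hiding ([_])
open import Relation.Nullary using (Dec; yes; no; does; contradiction)
open import Function using (_∘_)

open import Algebra.Properties.CommutativeSemigroup
  (CommutativeMonoid.commutativeSemigroup +-0-commutativeMonoid)
  using () renaming (interchange to +-interchange)
open import Algebra.Properties.CommutativeSemigroup
  (CommutativeMonoid.commutativeSemigroup *-1-commutativeMonoid)
  using () renaming (interchange to *-interchange; x∙yz≈y∙xz to *-left-comm)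
open import Algebra.Properties.Group +-0-group using (identityˡ-unique)

open ≡-Reasoning

private variable X Y : Set

∑ : List X → (X → ℚ) → ℚ
∑ xs f = foldr _+_ 0ℚ (map f xs)

∑₂ : List (X × Y) → (X → Y → ℚ) → ℚ
∑₂ xs f = ∑ xs (uncurry f)

infix 6.5 ∑ ∑₂
syntax ∑ xs (λ x → e) = ∑[ x ← xs ] e
syntax ∑₂ xs (λ x y → e) = ∑[ x , y ← xs ] e

∑-++ : (xs ys : List X) (f : X → ℚ) → ∑ (xs ++ ys) f ≡ ∑ xs f + ∑ ys f
∑-++ []       ys f = sym (+-identityˡ _)
∑-++ (x ∷ xs) ys f = trans (cong (f x +_) (∑-++ xs ys f)) (sym (+-assoc (f x) _ _))

∑-cong : (xs : List X) {f g : X → ℚ} → (∀ x → f x ≡ g x) → ∑ xs f ≡ ∑ xs g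
∑-cong []       f≗g = refl
∑-cong (x ∷ xs) f≗g = cong₂ _+_ (f≗g x) (∑-cong xs f≗g)

∑-zero : (xs : List X) {f : X → ℚ} → (∀ x → f x ≡ 0ℚ) → ∑ xs f ≡ 0ℚ
∑-zero []       f≗0 = refl
∑-zero (x ∷ xs) f≗0 = trans (cong₂ _+_ (f≗0 x) (∑-zero xs f≗0)) (+-identityˡ 0ℚ)

∑-distrib-+ : (xs : List X) (f g : X → ℚ) →
              ∑[ x ← xs ] (f x + g x) ≡ ∑ xs f + ∑ xs g
∑-distrib-+ []       f g = sym (+-identityˡ 0ℚ)
∑-distrib-+ (x ∷ xs) f g =
  trans (cong (f x + g x +_) (∑-distrib-+ xs f g)) (+-interchange (f x) (g x) _ _)

*-distribˡ-∑ : (c : ℚ) (xs : List X) (f : X → ℚ) → c * ∑ xs f ≡ ∑[ x ← xs ] c * f x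
*-distribˡ-∑ c []       f = *-zeroʳ c
*-distribˡ-∑ c (x ∷ xs) f =
  trans (*-distribˡ-+ c (f x) _) (cong (c * f x +_) (*-distribˡ-∑ c xs f))

*-distribʳ-∑ : (c : ℚ) (xs : List X) (f : X → ℚ) → ∑ xs f * c ≡ ∑[ x ← xs ] f x * c
*-distribʳ-∑ c []       f = *-zeroˡ c
*-distribʳ-∑ c (x ∷ xs) f =
  trans (*-distribʳ-+ c (f x) _) (cong (f x * c +_) (*-distribʳ-∑ c xs f))

∑-map : (g : Y → X) (ys : List Y) (f : X → ℚ) →
        ∑ (map g ys) f ≡ ∑[ y ← ys ] f (g y)
∑-map g []       f = refl
∑-map g (y ∷ ys) f = cong (f (g y) +_) (∑-map g ys f)

∑-concatMap : (g : Y → List X) (ys : List Y) (f : X → ℚ) →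
              ∑ (concatMap g ys) f ≡ ∑[ y ← ys ] ∑ (g y) f
∑-concatMap g []       f = refl
∑-concatMap g (y ∷ ys) f =
  trans (∑-++ (g y) _ f) (cong (∑ (g y) f +_) (∑-concatMap g ys f))

∑-comm : (xs : List X) (ys : List Y) (f : X → Y → ℚ) →
         ∑[ x ← xs ] ∑[ y ← ys ] f x y ≡ ∑[ y ← ys ] ∑[ x ← xs ] f x y
∑-comm []       ys f = sym (∑-zero ys (λ _ → refl))
∑-comm (x ∷ xs) ys f = begin
  ∑ ys (f x) + ∑[ x′ ← xs ] ∑ ys (f x′)       ≡⟨ cong (∑ ys (f x) +_) (∑-comm xs ys f) ⟩
  ∑ ys (f x) + ∑[ y ← ys ] ∑[ x′ ← xs ] f x′ y ≡⟨ ∑-distrib-+ ys (f x) _ ⟨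
  ∑[ y ← ys ] (f x y + ∑[ x′ ← xs ] f x′ y)    ∎

sum-++ : (xs ys : List ℚ) → foldr _+_ 0ℚ (xs ++ ys) ≡ foldr _+_ 0ℚ xs + foldr _+_ 0ℚ ys
sum-++ []       ys = sym (+-identityˡ _)
sum-++ (x ∷ xs) ys = trans (cong (x +_) (sum-++ xs ys)) (sym (+-assoc x _ _))

sum-concatMap : (g : X → List ℚ) (xs : List X) →
                foldr _+_ 0ℚ (concatMap g xs) ≡ ∑[ x ← xs ] foldr _+_ 0ℚ (g x)
sum-concatMap g []       = refl
sum-concatMap g (x ∷ xs) = trans (sum-++ (g x) _) (cong (foldr _+_ 0ℚ (g x) +_) (sum-concatMap g xs))

∑₂-cong : (xs : List (X × Y)) {f g : X → Y → ℚ} → (∀ x y → f x y ≡ g x y) →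
          ∑₂ xs f ≡ ∑₂ xs g
∑₂-cong xs f≗g = ∑-cong xs (λ (x , y) → f≗g x y)

∑₂-zero : (xs : List (X × Y)) {f : X → Y → ℚ} → (∀ x y → f x y ≡ 0ℚ) → ∑₂ xs f ≡ 0ℚ
∑₂-zero xs f≗0 = ∑-zero xs (λ (x , y) → f≗0 x y)

∑₂-comm : {Z W : Set} (xs : List (X × Y)) (ys : List (Z × W)) (f : X → Y → Z → W → ℚ) →
          ∑[ a , b ← xs ] ∑[ c , d ← ys ] f a b c d ≡ ∑[ c , d ← ys ] ∑[ a , b ← xs ] f a b c d
∑₂-comm xs ys f = ∑-comm xs ys (λ (a , b) (c , d) → f a b c d)

∑-*-∑ : (xs : List X) (ys : List Y) (f : X → ℚ) (g : Y → ℚ) →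
        ∑ xs f * ∑ ys g ≡ ∑[ x ← xs ] ∑[ y ← ys ] f x * g y
∑-*-∑ xs ys f g =
  trans (*-distribʳ-∑ (∑ ys g) xs f) (∑-cong xs (λ x → *-distribˡ-∑ (f x) ys g))

if-then-0 : ∀ b c → (if b then c else 0ℚ) ≡ c * (if b then 1ℚ else 0ℚ)
if-then-0 true  c = sym (*-identityʳ c)
if-then-0 false c = sym (*-zeroʳ c)

module Coefficients (𝔸 : Alphabet) where
  open Over 𝔸

  δ : Word → Word → ℚ
  δ u v = if does (u ≟W v) then 1ℚ else 0ℚ

  δ-sym : ∀ u v → δ u v ≡ δ v u
  δ-sym u v with u ≟W v | v ≟W u
  ... | yes _   | yes _   = refl
  ... | no _    | no _    = refl
  ... | yes u≡v | no v≢u  = contradiction (sym u≡v) v≢u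
  ... | no u≢v  | yes v≡u = contradiction (sym v≡u) u≢v

  δ-∷ : ∀ a b u v → δ (a ∷ u) (b ∷ v) ≡ δ [ a ] [ b ] * δ u v
  δ-∷ a b u v with a ≟L b
  ... | yes _ = sym (*-identityˡ (δ u v))
  ... | no _  = sym (*-zeroˡ (δ u v))

  coeff-∑ : ∀ P W → coeff P W ≡ ∑[ c , u ← P ] c * δ u W
  coeff-∑ []            W = refl
  coeff-∑ ((c , u) ∷ P) W = cong₂ _+_ (if-then-0 (does (u ≟W W)) c) (coeff-∑ P W)

  coeff-mono : ∀ u W → coeff (mono u) W ≡ δ u W
  coeff-mono u W = +-identityʳ (δ u W)

  coeff-concatMap : (f : X → Poly) (xs : List X) (W : Word) →
                    coeff (concatMap f xs) W ≡ ∑[ x ← xs ] coeff (f x) W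
  coeff-concatMap f xs W = begin
    coeff (concatMap f xs) W                  ≡⟨ coeff-∑ (concatMap f xs) W ⟩
    ∑[ c , u ← concatMap f xs ] c * δ u W     ≡⟨ ∑-concatMap f xs _ ⟩
    ∑[ x ← xs ] ∑[ c , u ← f x ] c * δ u W    ≡⟨ ∑-cong xs (λ x → coeff-∑ (f x) W) ⟨
    ∑[ x ← xs ] coeff (f x) W                 ∎

  coeff-• : ∀ c P W → coeff (c • P) W ≡ c * coeff P W
  coeff-• c P W = begin
    coeff (c • P) W                   ≡⟨ coeff-∑ (c • P) W ⟩
    ∑[ d , u ← c • P ] d * δ u W      ≡⟨ ∑-map _ P _ ⟩
    ∑[ d , u ← P ] (c * d) * δ u W    ≡⟨ ∑₂-cong P (λ d u → *-assoc c d (δ u W)) ⟩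
    ∑[ d , u ← P ] c * (d * δ u W)    ≡⟨ *-distribˡ-∑ c P _ ⟨
    c * (∑[ d , u ← P ] d * δ u W)    ≡⟨ cong (c *_) (coeff-∑ P W) ⟨
    c * coeff P W                     ∎

  ∑-splits-∷ : ∀ b w (f : Word → Word → ℚ) →
               ∑₂ (splits (b ∷ w)) f ≡ f [] (b ∷ w) + ∑[ x , y ← splits w ] f (b ∷ x) y
  ∑-splits-∷ b w f = cong (f [] (b ∷ w) +_) (∑-map _ (splits w) (uncurry f))

  ∑-desh-∷ : ∀ a w (f : Word → Word → ℚ) →
             ∑₂ (desh (a ∷ w)) f ≡
             ∑[ x , y ← desh w ] f (a ∷ x) y + ∑[ x , y ← desh w ] f x (a ∷ y)
  ∑-desh-∷ a w f =
    trans (∑-++ (map _ (desh w)) _ (uncurry f))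
          (cong₂ _+_ (∑-map _ (desh w) (uncurry f)) (∑-map _ (desh w) (uncurry f)))

  ∑-splits-[]ˡ : ∀ W (f : Word → Word → ℚ) → (∀ c x y → f (c ∷ x) y ≡ 0ℚ) →
                 ∑₂ (splits W) f ≡ f [] W
  ∑-splits-[]ˡ []      f f≗0 = +-identityʳ (f [] [])
  ∑-splits-[]ˡ (b ∷ w) f f≗0 = begin
    ∑₂ (splits (b ∷ w)) f
      ≡⟨ ∑-splits-∷ b w f ⟩
    f [] (b ∷ w) + ∑[ x , y ← splits w ] f (b ∷ x) y
      ≡⟨ cong (f [] (b ∷ w) +_) (∑₂-zero (splits w) (f≗0 b)) ⟩
    f [] (b ∷ w) + 0ℚ
      ≡⟨ +-identityʳ (f [] (b ∷ w)) ⟩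
    f [] (b ∷ w) ∎

  ∑-splits-counitˡ : ∀ W (g : Word → ℚ) → ∑[ x , y ← splits W ] δ [] x * g y ≡ g W
  ∑-splits-counitˡ W g =
    trans (∑-splits-[]ˡ W _ (λ c x y → *-zeroˡ (g y))) (*-identityˡ (g W))

  ∑-splits-counitʳ : ∀ W (f : Word → ℚ) → ∑[ x , y ← splits W ] f x * δ [] y ≡ f W
  ∑-splits-counitʳ []      f = trans (+-identityʳ (f [] * 1ℚ)) (*-identityʳ (f []))
  ∑-splits-counitʳ (b ∷ w) f = begin
    ∑[ x , y ← splits (b ∷ w) ] f x * δ [] y             ≡⟨ ∑-splits-∷ b w (λ x y → f x * δ [] y) ⟩
    f [] * 0ℚ + ∑[ x , y ← splits w ] f (b ∷ x) * δ [] y ≡⟨ cong (_+ rest) (*-zeroʳ (f [])) ⟩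
    0ℚ + ∑[ x , y ← splits w ] f (b ∷ x) * δ [] y        ≡⟨ +-identityˡ rest ⟩
    ∑[ x , y ← splits w ] f (b ∷ x) * δ [] y             ≡⟨ ∑-splits-counitʳ w (λ x → f (b ∷ x)) ⟩
    f (b ∷ w)                                            ∎
    where rest = ∑[ x , y ← splits w ] f (b ∷ x) * δ [] y

  ∑-desh-counitˡ : ∀ U (g : Word → ℚ) → ∑[ x , y ← desh U ] δ [] x * g y ≡ g U
  ∑-desh-counitˡ []      g = trans (+-identityʳ (1ℚ * g [])) (*-identityˡ (g []))
  ∑-desh-counitˡ (a ∷ w) g = begin
    ∑[ x , y ← desh (a ∷ w) ] δ [] x * g y                 ≡⟨ ∑-desh-∷ a w (λ x y → δ [] x * g y) ⟩
    ∑[ x , y ← desh w ] 0ℚ * g y + ∑[ x , y ← desh w ] δ [] x * g (a ∷ y)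
      ≡⟨ cong₂ _+_ (∑₂-zero (desh w) (λ x y → *-zeroˡ (g y))) (∑-desh-counitˡ w (λ y → g (a ∷ y))) ⟩
    0ℚ + g (a ∷ w)                                          ≡⟨ +-identityˡ (g (a ∷ w)) ⟩
    g (a ∷ w)                                               ∎

  ∑-desh-counitʳ : ∀ U (f : Word → ℚ) → ∑[ x , y ← desh U ] f x * δ [] y ≡ f U
  ∑-desh-counitʳ []      f = trans (+-identityʳ (f [] * 1ℚ)) (*-identityʳ (f []))
  ∑-desh-counitʳ (a ∷ w) f = begin
    ∑[ x , y ← desh (a ∷ w) ] f x * δ [] y                 ≡⟨ ∑-desh-∷ a w (λ x y → f x * δ [] y) ⟩
    ∑[ x , y ← desh w ] f (a ∷ x) * δ [] y + ∑[ x , y ← desh w ] f x * 0ℚ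
      ≡⟨ cong₂ _+_ (∑-desh-counitʳ w (λ x → f (a ∷ x))) (∑₂-zero (desh w) (λ x y → *-zeroʳ (f x))) ⟩
    f (a ∷ w) + 0ℚ                                          ≡⟨ +-identityʳ (f (a ∷ w)) ⟩
    f (a ∷ w)                                               ∎

  ∑-desh-assoc : ∀ U (f : Word → Word → Word → ℚ) →
    ∑[ U₁₂ , U₃ ← desh U ] ∑[ U₁ , U₂ ← desh U₁₂ ] f U₁ U₂ U₃ ≡
    ∑[ U₁ , U₂₃ ← desh U ] ∑[ U₂ , U₃ ← desh U₂₃ ] f U₁ U₂ U₃
  ∑-desh-assoc []      f = refl
  ∑-desh-assoc (a ∷ w) f = begin
    ∑[ x , z ← desh (a ∷ w) ] ∑[ u , v ← desh x ] f u v z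
      ≡⟨ ∑-desh-∷ a w (λ x z → ∑[ u , v ← desh x ] f u v z) ⟩
    ∑[ x , z ← desh w ] ∑[ u , v ← desh (a ∷ x) ] f u v z + L₃
      ≡⟨ cong (_+ L₃) (∑₂-cong (desh w) (λ x z → ∑-desh-∷ a x (λ u v → f u v z))) ⟩
    ∑[ x , z ← desh w ] (∑[ u , v ← desh x ] f (a ∷ u) v z + ∑[ u , v ← desh x ] f u (a ∷ v) z) + L₃
      ≡⟨ cong (_+ L₃) (∑-distrib-+ (desh w) _ _) ⟩
    L₁ + L₂ + L₃
      ≡⟨ cong₂ _+_ (cong₂ _+_ (∑-desh-assoc w (λ u v z → f (a ∷ u) v z))
                              (∑-desh-assoc w (λ u v z → f u (a ∷ v) z)))
                   (∑-desh-assoc w (λ u v z → f u v (a ∷ z))) ⟩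
    R₁ + R₂ + R₃
      ≡⟨ +-assoc R₁ R₂ R₃ ⟩
    R₁ + (R₂ + R₃)
      ≡⟨ cong (R₁ +_) (∑-distrib-+ (desh w) _ _) ⟨
    R₁ + ∑[ u , x ← desh w ] (∑[ v , z ← desh x ] f u (a ∷ v) z + ∑[ v , z ← desh x ] f u v (a ∷ z))
      ≡⟨ cong (R₁ +_) (∑₂-cong (desh w) (λ u x → ∑-desh-∷ a x (f u))) ⟨
    R₁ + ∑[ u , x ← desh w ] ∑[ v , z ← desh (a ∷ x) ] f u v z
      ≡⟨ ∑-desh-∷ a w (λ u x → ∑[ v , z ← desh x ] f u v z) ⟨
    ∑[ u , x ← desh (a ∷ w) ] ∑[ v , z ← desh x ] f u v z ∎
    where
    L₁ = ∑[ x , z ← desh w ] ∑[ u , v ← desh x ] f (a ∷ u) v z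
    L₂ = ∑[ x , z ← desh w ] ∑[ u , v ← desh x ] f u (a ∷ v) z
    L₃ = ∑[ x , z ← desh w ] ∑[ u , v ← desh x ] f u v (a ∷ z)
    R₁ = ∑[ u , x ← desh w ] ∑[ v , z ← desh x ] f (a ∷ u) v z
    R₂ = ∑[ u , x ← desh w ] ∑[ v , z ← desh x ] f u (a ∷ v) z
    R₃ = ∑[ u , x ← desh w ] ∑[ v , z ← desh x ] f u v (a ∷ z)

  ∑-splits-assoc : ∀ W (f : Word → Word → Word → ℚ) →
    ∑[ W₁₂ , W₃ ← splits W ] ∑[ W₁ , W₂ ← splits W₁₂ ] f W₁ W₂ W₃ ≡
    ∑[ W₁ , W₂₃ ← splits W ] ∑[ W₂ , W₃ ← splits W₂₃ ] f W₁ W₂ W₃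
  ∑-splits-assoc []      f = refl
  ∑-splits-assoc (b ∷ w) f = begin
    ∑[ x , z ← splits (b ∷ w) ] ∑[ u , v ← splits x ] f u v z
      ≡⟨ ∑-splits-∷ b w (λ x z → ∑[ u , v ← splits x ] f u v z) ⟩
    (f [] [] (b ∷ w) + 0ℚ) + ∑[ x , z ← splits w ] ∑[ u , v ← splits (b ∷ x) ] f u v z
      ≡⟨ cong₂ _+_ (+-identityʳ (f [] [] (b ∷ w)))
                   (∑₂-cong (splits w) (λ x z → ∑-splits-∷ b x (λ u v → f u v z))) ⟩
    f [] [] (b ∷ w) + ∑[ x , z ← splits w ] (f [] (b ∷ x) z + ∑[ u , v ← splits x ] f (b ∷ u) v z)
      ≡⟨ cong (f [] [] (b ∷ w) +_) (∑-distrib-+ (splits w) _ _) ⟩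
    f [] [] (b ∷ w) + (M + ∑[ x , z ← splits w ] ∑[ u , v ← splits x ] f (b ∷ u) v z)
      ≡⟨ cong (λ r → f [] [] (b ∷ w) + (M + r)) (∑-splits-assoc w (λ u v z → f (b ∷ u) v z)) ⟩
    f [] [] (b ∷ w) + (M + R)
      ≡⟨ +-assoc (f [] [] (b ∷ w)) M R ⟨
    (f [] [] (b ∷ w) + M) + R
      ≡⟨ cong (_+ R) (∑-splits-∷ b w (f [])) ⟨
    ∑[ v , z ← splits (b ∷ w) ] f [] v z + R
      ≡⟨ ∑-splits-∷ b w (λ u x → ∑[ v , z ← splits x ] f u v z) ⟨
    ∑[ u , x ← splits (b ∷ w) ] ∑[ v , z ← splits x ] f u v z ∎
    where
    M = ∑[ x , z ← splits w ] f [] (b ∷ x) z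
    R = ∑[ u , x ← splits w ] ∑[ v , z ← splits x ] f (b ∷ u) v z

  ∑-desh-cong-≤ : ∀ w {f g : Word → Word → ℚ} →
    (∀ x y → length x ≤ length w → length y ≤ length w → f x y ≡ g x y) →
    ∑₂ (desh w) f ≡ ∑₂ (desh w) g
  ∑-desh-cong-≤ []      f≗g = cong (_+ 0ℚ) (f≗g [] [] z≤n z≤n)
  ∑-desh-cong-≤ (a ∷ w) {f} {g} f≗g = begin
    ∑₂ (desh (a ∷ w)) f
      ≡⟨ ∑-desh-∷ a w f ⟩
    ∑[ x , y ← desh w ] f (a ∷ x) y + ∑[ x , y ← desh w ] f x (a ∷ y)
      ≡⟨ cong₂ _+_ (∑-desh-cong-≤ w (λ x y |x|≤ |y|≤ → f≗g (a ∷ x) y (s≤s |x|≤) (ℕ.m≤n⇒m≤1+n |y|≤)))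
                   (∑-desh-cong-≤ w (λ x y |x|≤ |y|≤ → f≗g x (a ∷ y) (ℕ.m≤n⇒m≤1+n |x|≤) (s≤s |y|≤))) ⟩
    ∑[ x , y ← desh w ] g (a ∷ x) y + ∑[ x , y ← desh w ] g x (a ∷ y)
      ≡⟨ ∑-desh-∷ a w g ⟨
    ∑₂ (desh (a ∷ w)) g ∎

  ∑-splits-δ : ∀ u v W → ∑[ x , y ← splits W ] δ u x * δ v y ≡ δ (u ++ v) W
  ∑-splits-δ []      v W       = ∑-splits-counitˡ W (δ v)
  ∑-splits-δ (a ∷ u) v []      = trans (+-identityʳ (0ℚ * δ v [])) (*-zeroˡ (δ v []))
  ∑-splits-δ (a ∷ u) v (b ∷ w) = begin
    ∑[ x , y ← splits (b ∷ w) ] δ (a ∷ u) x * δ v y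
      ≡⟨ ∑-splits-∷ b w (λ x y → δ (a ∷ u) x * δ v y) ⟩
    0ℚ * δ v (b ∷ w) + ∑[ x , y ← splits w ] δ (a ∷ u) (b ∷ x) * δ v y
      ≡⟨ trans (cong (_+ rest) (*-zeroˡ (δ v (b ∷ w)))) (+-identityˡ rest) ⟩
    ∑[ x , y ← splits w ] δ (a ∷ u) (b ∷ x) * δ v y
      ≡⟨ ∑₂-cong (splits w) (λ x y →
           trans (cong (_* δ v y) (δ-∷ a b u x)) (*-assoc δab (δ u x) (δ v y))) ⟩
    ∑[ x , y ← splits w ] δab * (δ u x * δ v y)
      ≡⟨ *-distribˡ-∑ δab (splits w) _ ⟨
    δab * (∑[ x , y ← splits w ] δ u x * δ v y)
      ≡⟨ cong (δab *_) (∑-splits-δ u v w) ⟩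
    δab * δ (u ++ v) w
      ≡⟨ δ-∷ a b (u ++ v) w ⟨
    δ (a ∷ u ++ v) (b ∷ w) ∎
    where
    δab  = δ [ a ] [ b ]
    rest = ∑[ x , y ← splits w ] δ (a ∷ u) (b ∷ x) * δ v y

  coeff-· : ∀ P Q W → coeff (P · Q) W ≡ ∑[ W₁ , W₂ ← splits W ] coeff P W₁ * coeff Q W₂
  coeff-· P Q W = begin
    coeff (P · Q) W
      ≡⟨ coeff-∑ (P · Q) W ⟩
    ∑[ c , u ← P · Q ] c * δ u W
      ≡⟨ trans (∑-concatMap _ P _) (∑₂-cong P (λ c u → ∑-map _ Q _)) ⟩
    ∑[ c , u ← P ] ∑[ d , v ← Q ] (c * d) * δ (u ++ v) W
      ≡⟨ ∑₂-cong P (λ c u → ∑₂-cong Q (λ d v → deconcatenate c d u v)) ⟩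
    ∑[ c , u ← P ] ∑[ d , v ← Q ] ∑[ W₁ , W₂ ← splits W ] monomial c u W₁ * monomial d v W₂
      ≡⟨ ∑₂-cong P (λ c u → ∑₂-comm Q (splits W) _) ⟩
    ∑[ c , u ← P ] ∑[ W₁ , W₂ ← splits W ] ∑[ d , v ← Q ] monomial c u W₁ * monomial d v W₂
      ≡⟨ ∑₂-comm P (splits W) _ ⟩
    ∑[ W₁ , W₂ ← splits W ] ∑[ c , u ← P ] ∑[ d , v ← Q ] monomial c u W₁ * monomial d v W₂
      ≡⟨ ∑₂-cong (splits W) (λ W₁ W₂ → ∑-*-∑ P Q _ _) ⟨
    ∑[ W₁ , W₂ ← splits W ] (∑[ c , u ← P ] monomial c u W₁) * (∑[ d , v ← Q ] monomial d v W₂)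
      ≡⟨ ∑₂-cong (splits W) (λ W₁ W₂ → cong₂ _*_ (coeff-∑ P W₁) (coeff-∑ Q W₂)) ⟨
    ∑[ W₁ , W₂ ← splits W ] coeff P W₁ * coeff Q W₂ ∎
    where
    monomial : ℚ → Word → Word → ℚ
    monomial c u W′ = c * δ u W′
    deconcatenate : ∀ c d u v →
      (c * d) * δ (u ++ v) W ≡ ∑[ W₁ , W₂ ← splits W ] monomial c u W₁ * monomial d v W₂
    deconcatenate c d u v = begin
      (c * d) * δ (u ++ v) W
        ≡⟨ cong ((c * d) *_) (∑-splits-δ u v W) ⟨
      (c * d) * (∑[ W₁ , W₂ ← splits W ] δ u W₁ * δ v W₂)
        ≡⟨ *-distribˡ-∑ (c * d) (splits W) _ ⟩
      ∑[ W₁ , W₂ ← splits W ] (c * d) * (δ u W₁ * δ v W₂)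
        ≡⟨ ∑₂-cong (splits W) (λ W₁ W₂ → *-interchange c d (δ u W₁) (δ v W₂)) ⟩
      ∑[ W₁ , W₂ ← splits W ] monomial c u W₁ * monomial d v W₂ ∎

  ∑-Δw : ∀ w (f : ℚ × Word × Word → ℚ) → ∑ (Δw w) f ≡ ∑[ u , v ← desh w ] f (1ℚ , u , v)
  ∑-Δw []      f = refl
  ∑-Δw (a ∷ w) f = begin
    ∑ (Δw (a ∷ w)) f
      ≡⟨ ∑-++ (map _ (Δw w)) _ f ⟩
    ∑ (map _ (Δw w)) f + ∑ (map _ (Δw w)) f
      ≡⟨ cong₂ _+_ (trans (∑-map _ (Δw w) f) (∑-Δw w _)) (trans (∑-map _ (Δw w) f) (∑-Δw w _)) ⟩
    ∑[ u , v ← desh w ] f (1ℚ , a ∷ u , v) + ∑[ u , v ← desh w ] f (1ℚ , u , a ∷ v)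
      ≡⟨ ∑-desh-∷ a w (λ u v → f (1ℚ , u , v)) ⟨
    ∑[ u , v ← desh (a ∷ w) ] f (1ℚ , u , v) ∎

  ∑-Δ-mono : ∀ q (f : ℚ × Word × Word → ℚ) →
             ∑ (Δ (mono q)) f ≡ ∑[ u , v ← desh q ] f (1ℚ , u , v)
  ∑-Δ-mono q f = begin
    ∑ (Δ (mono q)) f          ≡⟨ ∑-++ (map _ (Δw q)) [] f ⟩
    ∑ (map _ (Δw q)) f + 0ℚ   ≡⟨ +-identityʳ _ ⟩
    ∑ (map _ (Δw q)) f        ≡⟨ trans (∑-map _ (Δw q) f) (∑-Δw q _) ⟩
    ∑[ u , v ← desh q ] f (1ℚ , u , v) ∎

  -- Convolution for the shuffle coproduct, (P ⋆ Q)(q) = P(q₍₁₎) Q(q₍₂₎): both q ▷ BC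
  -- (by ext-right) and the Grossman–Larson product q ⊛ V are of this form.
  infixl 7 _⋆_
  _⋆_ : (Word → Poly) → (Word → Poly) → Word → Poly
  (P ⋆ Q) q = concatMap (λ (c , q₁ , q₂) → c • (P q₁ · Q q₂)) (Δ (mono q))

  coeff-⋆ : ∀ (P Q : Word → Poly) q W →
            coeff ((P ⋆ Q) q) W ≡
            ∑[ q₁ , q₂ ← desh q ] ∑[ W₁ , W₂ ← splits W ] coeff (P q₁) W₁ * coeff (Q q₂) W₂
  coeff-⋆ P Q q W = begin
    coeff ((P ⋆ Q) q) W
      ≡⟨ trans (coeff-concatMap _ (Δ (mono q)) W) (∑-Δ-mono q _) ⟩
    ∑[ q₁ , q₂ ← desh q ] coeff (1ℚ • (P q₁ · Q q₂)) W
      ≡⟨ ∑₂-cong (desh q) (λ q₁ q₂ → trans (coeff-• 1ℚ (P q₁ · Q q₂) W) (*-identityˡ _)) ⟩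
    ∑[ q₁ , q₂ ← desh q ] coeff (P q₁ · Q q₂) W
      ≡⟨ ∑₂-cong (desh q) (λ q₁ q₂ → coeff-· (P q₁) (Q q₂) W) ⟩
    ∑[ q₁ , q₂ ← desh q ] ∑[ W₁ , W₂ ← splits W ] coeff (P q₁) W₁ * coeff (Q q₂) W₂ ∎

  ⧢•-expand : ∀ F G U V →
    (F ⧢• G) U V ≡ ∑[ U₁ , U₂ ← desh U ] ∑[ V₁ , V₂ ← splits V ] F U₁ V₁ * G U₂ V₂
  ⧢•-expand F G U V = sum-concatMap _ (desh U)

  ⧢•-congʳ : ∀ F {G H} → (∀ U V → G U V ≡ H U V) → ∀ U V → (F ⧢• G) U V ≡ (F ⧢• H) U V
  ⧢•-congʳ F {G} {H} G≗H U V = begin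
    (F ⧢• G) U V
      ≡⟨ ⧢•-expand F G U V ⟩
    ∑[ U₁ , U₂ ← desh U ] ∑[ V₁ , V₂ ← splits V ] F U₁ V₁ * G U₂ V₂
      ≡⟨ ∑₂-cong (desh U) (λ U₁ U₂ → ∑₂-cong (splits V) (λ V₁ V₂ → cong (F U₁ V₁ *_) (G≗H U₂ V₂))) ⟩
    ∑[ U₁ , U₂ ← desh U ] ∑[ V₁ , V₂ ← splits V ] F U₁ V₁ * H U₂ V₂
      ≡⟨ ⧢•-expand F H U V ⟨
    (F ⧢• H) U V ∎

  ⧢•-∑ʳ : ∀ (xs : List X) F (G : X → Coef2) U V →
    ∑[ x ← xs ] (F ⧢• G x) U V ≡ (F ⧢• (λ U′ V′ → ∑[ x ← xs ] G x U′ V′)) U V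
  ⧢•-∑ʳ xs F G U V = begin
    ∑[ x ← xs ] (F ⧢• G x) U V
      ≡⟨ ∑-cong xs (λ x → ⧢•-expand F (G x) U V) ⟩
    ∑[ x ← xs ] ∑[ U₁ , U₂ ← desh U ] ∑[ V₁ , V₂ ← splits V ] F U₁ V₁ * G x U₂ V₂
      ≡⟨ ∑-comm xs (desh U) _ ⟩
    ∑[ U₁ , U₂ ← desh U ] ∑[ x ← xs ] ∑[ V₁ , V₂ ← splits V ] F U₁ V₁ * G x U₂ V₂
      ≡⟨ ∑₂-cong (desh U) (λ U₁ U₂ → ∑-comm xs (splits V) _) ⟩
    ∑[ U₁ , U₂ ← desh U ] ∑[ V₁ , V₂ ← splits V ] ∑[ x ← xs ] F U₁ V₁ * G x U₂ V₂
      ≡⟨ ∑₂-cong (desh U) (λ U₁ U₂ → ∑₂-cong (splits V) (λ V₁ V₂ →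
           *-distribˡ-∑ (F U₁ V₁) xs (λ x → G x U₂ V₂))) ⟨
    ∑[ U₁ , U₂ ← desh U ] ∑[ V₁ , V₂ ← splits V ] F U₁ V₁ * (∑[ x ← xs ] G x U₂ V₂)
      ≡⟨ ⧢•-expand F _ U V ⟨
    (F ⧢• (λ U′ V′ → ∑[ x ← xs ] G x U′ V′)) U V ∎

  ⧢•-assoc : ∀ F G H U V → ((F ⧢• G) ⧢• H) U V ≡ (F ⧢• (G ⧢• H)) U V
  ⧢•-assoc F G H U V = begin
    ((F ⧢• G) ⧢• H) U V
      ≡⟨ ⧢•-expand (F ⧢• G) H U V ⟩
    ∑[ U₁₂ , U₃ ← desh U ] ∑[ V₁₂ , V₃ ← splits V ] (F ⧢• G) U₁₂ V₁₂ * H U₃ V₃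
      ≡⟨ ∑₂-cong (desh U) (λ U₁₂ U₃ → ∑₂-cong (splits V) (λ V₁₂ V₃ → expandˡ U₁₂ U₃ V₁₂ V₃)) ⟩
    ∑[ U₁₂ , U₃ ← desh U ] ∑[ V₁₂ , V₃ ← splits V ]
      ∑[ U₁ , U₂ ← desh U₁₂ ] ∑[ V₁ , V₂ ← splits V₁₂ ] FGH U₁ U₂ U₃ V₁ V₂ V₃
      ≡⟨ ∑₂-cong (desh U) (λ U₁₂ U₃ → ∑₂-comm (splits V) (desh U₁₂) _) ⟩
    ∑[ U₁₂ , U₃ ← desh U ] ∑[ U₁ , U₂ ← desh U₁₂ ]
      ∑[ V₁₂ , V₃ ← splits V ] ∑[ V₁ , V₂ ← splits V₁₂ ] FGH U₁ U₂ U₃ V₁ V₂ V₃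
      ≡⟨ ∑-desh-assoc U _ ⟩
    ∑[ U₁ , U₂₃ ← desh U ] ∑[ U₂ , U₃ ← desh U₂₃ ]
      ∑[ V₁₂ , V₃ ← splits V ] ∑[ V₁ , V₂ ← splits V₁₂ ] FGH U₁ U₂ U₃ V₁ V₂ V₃
      ≡⟨ ∑₂-cong (desh U) (λ U₁ U₂₃ → ∑₂-cong (desh U₂₃) (λ U₂ U₃ → ∑-splits-assoc V _)) ⟩
    ∑[ U₁ , U₂₃ ← desh U ] ∑[ U₂ , U₃ ← desh U₂₃ ]
      ∑[ V₁ , V₂₃ ← splits V ] ∑[ V₂ , V₃ ← splits V₂₃ ] FGH U₁ U₂ U₃ V₁ V₂ V₃
      ≡⟨ ∑₂-cong (desh U) (λ U₁ U₂₃ → ∑₂-comm (desh U₂₃) (splits V) _) ⟩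
    ∑[ U₁ , U₂₃ ← desh U ] ∑[ V₁ , V₂₃ ← splits V ]
      ∑[ U₂ , U₃ ← desh U₂₃ ] ∑[ V₂ , V₃ ← splits V₂₃ ] FGH U₁ U₂ U₃ V₁ V₂ V₃
      ≡⟨ ∑₂-cong (desh U) (λ U₁ U₂₃ → ∑₂-cong (splits V) (λ V₁ V₂₃ → expandʳ U₁ U₂₃ V₁ V₂₃)) ⟨
    ∑[ U₁ , U₂₃ ← desh U ] ∑[ V₁ , V₂₃ ← splits V ] F U₁ V₁ * (G ⧢• H) U₂₃ V₂₃
      ≡⟨ ⧢•-expand F (G ⧢• H) U V ⟨
    (F ⧢• (G ⧢• H)) U V ∎
    where
    FGH : Word → Word → Word → Word → Word → Word → ℚ
    FGH U₁ U₂ U₃ V₁ V₂ V₃ = F U₁ V₁ * G U₂ V₂ * H U₃ V₃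

    expandˡ : ∀ U₁₂ U₃ V₁₂ V₃ → (F ⧢• G) U₁₂ V₁₂ * H U₃ V₃ ≡
      ∑[ U₁ , U₂ ← desh U₁₂ ] ∑[ V₁ , V₂ ← splits V₁₂ ] FGH U₁ U₂ U₃ V₁ V₂ V₃
    expandˡ U₁₂ U₃ V₁₂ V₃ = begin
      (F ⧢• G) U₁₂ V₁₂ * H U₃ V₃
        ≡⟨ cong (_* H U₃ V₃) (⧢•-expand F G U₁₂ V₁₂) ⟩
      (∑[ U₁ , U₂ ← desh U₁₂ ] ∑[ V₁ , V₂ ← splits V₁₂ ] F U₁ V₁ * G U₂ V₂) * H U₃ V₃
        ≡⟨ *-distribʳ-∑ (H U₃ V₃) (desh U₁₂) _ ⟩
      ∑[ U₁ , U₂ ← desh U₁₂ ] (∑[ V₁ , V₂ ← splits V₁₂ ] F U₁ V₁ * G U₂ V₂) * H U₃ V₃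
        ≡⟨ ∑₂-cong (desh U₁₂) (λ U₁ U₂ → *-distribʳ-∑ (H U₃ V₃) (splits V₁₂) _) ⟩
      ∑[ U₁ , U₂ ← desh U₁₂ ] ∑[ V₁ , V₂ ← splits V₁₂ ] FGH U₁ U₂ U₃ V₁ V₂ V₃ ∎

    expandʳ : ∀ U₁ U₂₃ V₁ V₂₃ → F U₁ V₁ * (G ⧢• H) U₂₃ V₂₃ ≡
      ∑[ U₂ , U₃ ← desh U₂₃ ] ∑[ V₂ , V₃ ← splits V₂₃ ] FGH U₁ U₂ U₃ V₁ V₂ V₃
    expandʳ U₁ U₂₃ V₁ V₂₃ = begin
      F U₁ V₁ * (G ⧢• H) U₂₃ V₂₃
        ≡⟨ cong (F U₁ V₁ *_) (⧢•-expand G H U₂₃ V₂₃) ⟩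
      F U₁ V₁ * (∑[ U₂ , U₃ ← desh U₂₃ ] ∑[ V₂ , V₃ ← splits V₂₃ ] G U₂ V₂ * H U₃ V₃)
        ≡⟨ *-distribˡ-∑ (F U₁ V₁) (desh U₂₃) _ ⟩
      ∑[ U₂ , U₃ ← desh U₂₃ ] F U₁ V₁ * (∑[ V₂ , V₃ ← splits V₂₃ ] G U₂ V₂ * H U₃ V₃)
        ≡⟨ ∑₂-cong (desh U₂₃) (λ U₂ U₃ → *-distribˡ-∑ (F U₁ V₁) (splits V₂₃) _) ⟩
      ∑[ U₂ , U₃ ← desh U₂₃ ] ∑[ V₂ , V₃ ← splits V₂₃ ] F U₁ V₁ * (G U₂ V₂ * H U₃ V₃)
        ≡⟨ ∑₂-cong (desh U₂₃) (λ U₂ U₃ → ∑₂-cong (splits V₂₃) (λ V₂ V₃ →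
             sym (*-assoc (F U₁ V₁) (G U₂ V₂) (H U₃ V₃)))) ⟩
      ∑[ U₂ , U₃ ← desh U₂₃ ] ∑[ V₂ , V₃ ← splits V₂₃ ] FGH U₁ U₂ U₃ V₁ V₂ V₃ ∎

  tensor1-δ : ∀ A₁ U V → tensor1 A₁ U V ≡ δ U A₁ * δ [] V
  tensor1-δ A₁ U V = begin
    tensor1 A₁ U V    ≡⟨ if-then-0 (does (U ≟W A₁)) (δ V []) ⟩
    δ V [] * δ U A₁   ≡⟨ cong (_* δ U A₁) (δ-sym V []) ⟩
    δ [] V * δ U A₁   ≡⟨ *-comm (δ [] V) (δ U A₁) ⟩
    δ U A₁ * δ [] V   ∎

  tensor1-⧢• : ∀ A₁ G U V → (tensor1 A₁ ⧢• G) U V ≡ ∑[ U₁ , U₂ ← desh U ] δ U₁ A₁ * G U₂ V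
  tensor1-⧢• A₁ G U V = begin
    (tensor1 A₁ ⧢• G) U V
      ≡⟨ ⧢•-expand (tensor1 A₁) G U V ⟩
    ∑[ U₁ , U₂ ← desh U ] ∑[ V₁ , V₂ ← splits V ] tensor1 A₁ U₁ V₁ * G U₂ V₂
      ≡⟨ ∑₂-cong (desh U) (λ U₁ U₂ → ∑₂-cong (splits V) (λ V₁ V₂ → begin
           tensor1 A₁ U₁ V₁ * G U₂ V₂       ≡⟨ cong (_* G U₂ V₂) (tensor1-δ A₁ U₁ V₁) ⟩
           δ U₁ A₁ * δ [] V₁ * G U₂ V₂      ≡⟨ *-assoc (δ U₁ A₁) (δ [] V₁) (G U₂ V₂) ⟩
           δ U₁ A₁ * (δ [] V₁ * G U₂ V₂)    ≡⟨ *-left-comm (δ U₁ A₁) (δ [] V₁) (G U₂ V₂) ⟩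
           δ [] V₁ * (δ U₁ A₁ * G U₂ V₂)    ∎)) ⟩
    ∑[ U₁ , U₂ ← desh U ] ∑[ V₁ , V₂ ← splits V ] δ [] V₁ * (δ U₁ A₁ * G U₂ V₂)
      ≡⟨ ∑₂-cong (desh U) (λ U₁ U₂ → ∑-splits-counitˡ V (λ V₂ → δ U₁ A₁ * G U₂ V₂)) ⟩
    ∑[ U₁ , U₂ ← desh U ] δ U₁ A₁ * G U₂ V ∎

  -- The coefficient at U ⊗ V of Σ_{A = A₁A₂} (A₁ ⊗ 𝟏) ⧢• F(A₂), by tensor1-⧢•.
  tensor1⋆ : (Word → Coef2) → Word → Coef2
  tensor1⋆ F A U V = ∑[ A₁ , A₂ ← splits A ] ∑[ U₁ , U₂ ← desh U ] δ U₁ A₁ * F A₂ U₂ V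

  tensor1⋆-cong : ∀ F G A U V → (∀ A′ U′ → F A′ U′ V ≡ G A′ U′ V) →
                  tensor1⋆ F A U V ≡ tensor1⋆ G A U V
  tensor1⋆-cong F G A U V F≗G = ∑₂-cong (splits A) (λ A₁ A₂ → ∑₂-cong (desh U) (λ U₁ U₂ →
    cong (δ U₁ A₁ *_) (F≗G A₂ U₂)))

  tensor1⋆-+ : ∀ F G A U V → tensor1⋆ F A U V + tensor1⋆ G A U V ≡
               tensor1⋆ (λ A′ U′ V′ → F A′ U′ V′ + G A′ U′ V′) A U V
  tensor1⋆-+ F G A U V = begin
    tensor1⋆ F A U V + tensor1⋆ G A U V
      ≡⟨ ∑-distrib-+ (splits A) _ _ ⟨
    ∑[ A₁ , A₂ ← splits A ] (∑[ U₁ , U₂ ← desh U ] δ U₁ A₁ * F A₂ U₂ V +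
                             ∑[ U₁ , U₂ ← desh U ] δ U₁ A₁ * G A₂ U₂ V)
      ≡⟨ ∑₂-cong (splits A) (λ A₁ A₂ → ∑-distrib-+ (desh U) _ _) ⟨
    ∑[ A₁ , A₂ ← splits A ] ∑[ U₁ , U₂ ← desh U ] (δ U₁ A₁ * F A₂ U₂ V + δ U₁ A₁ * G A₂ U₂ V)
      ≡⟨ ∑₂-cong (splits A) (λ A₁ A₂ → ∑₂-cong (desh U) (λ U₁ U₂ →
           *-distribˡ-+ (δ U₁ A₁) (F A₂ U₂ V) (G A₂ U₂ V))) ⟨
    tensor1⋆ (λ A′ U′ V′ → F A′ U′ V′ + G A′ U′ V′) A U V ∎

  ∑-facts-suc : ∀ n A (F : List Word → ℚ) →
    ∑ (facts (suc (suc n)) A) F ≡ ∑[ A₁ , A₂ ← splits A ] ∑[ As ← facts (suc n) A₂ ] F (A₁ ∷ As)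
  ∑-facts-suc n A F =
    trans (∑-concatMap _ (splits A) F) (∑₂-cong (splits A) (λ A₁ A₂ → ∑-map _ (facts (suc n) A₂) F))

  module Cotriangle (t : Prod) where

    ⟨_▷_∣_⟩ : Word → Word → Word → ℚ
    ⟨ u ▷ v ∣ W ⟩ = coeff (t u v) W

    ▷[_] : Word → Word → Poly
    ▷[ v ] u = ext t (mono u) (mono v)

    coeff-▷[] : ∀ u v W → coeff (▷[ v ] u) W ≡ ⟨ u ▷ v ∣ W ⟩
    coeff-▷[] u v W = begin
      coeff (▷[ v ] u) W
        ≡⟨ cong (λ P → coeff P W) (trans (++-identityʳ (1ℚ • t u v ++ [])) (++-identityʳ (1ℚ • t u v))) ⟩
      coeff (1ℚ • t u v) W  ≡⟨ coeff-• 1ℚ (t u v) W ⟩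
      1ℚ * ⟨ u ▷ v ∣ W ⟩    ≡⟨ *-identityˡ _ ⟩
      ⟨ u ▷ v ∣ W ⟩         ∎

    ◁ : Word → Coef2
    ◁ A U V = ⟨ U ▷ V ∣ A ⟩

    ◁[_] : ℕ → Word → Coef2
    ◁[ m ] A U V = if length V ℕ.≡ᵇ m then ◁ A U V else 0ℚ

    ◁-≡ : ∀ {m} A U V → length V ≡ m → ◁[ m ] A U V ≡ ◁ A U V
    ◁-≡ {m} A U V |V|≡m with length V ℕ.≡ᵇ m | ℕ.≡⇒≡ᵇ (length V) m |V|≡m
    ... | true | _ = refl

    ◁-≢ : ∀ {m} A U V → length V ≢ m → ◁[ m ] A U V ≡ 0ℚ
    ◁-≢ {m} A U V |V|≢m with length V ℕ.≡ᵇ m | ℕ.≡ᵇ⇒≡ (length V) m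
    ... | false | _       = refl
    ... | true  | T⇒|V|≡m = contradiction (T⇒|V|≡m _) |V|≢m

    irr≡◁[1] : ∀ A U V → irr t A U V ≡ ◁[ 1 ] A U V
    irr≡◁[1] A U []          = refl
    irr≡◁[1] A U (b ∷ [])    = coeff-▷[] U [ b ] A
    irr≡◁[1] A U (b ∷ c ∷ V) = refl

    ∑-splits-irr : ∀ A U b r (g : Word → ℚ) →
      ∑[ V₁ , V₂ ← splits (b ∷ r) ] irr t A U V₁ * g V₂ ≡ ⟨ U ▷ [ b ] ∣ A ⟩ * g r
    ∑-splits-irr A U b r g = begin
      ∑[ V₁ , V₂ ← splits (b ∷ r) ] irr t A U V₁ * g V₂
        ≡⟨ ∑-splits-∷ b r (λ V₁ V₂ → irr t A U V₁ * g V₂) ⟩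
      0ℚ * g (b ∷ r) + rest
        ≡⟨ trans (cong (_+ rest) (*-zeroˡ (g (b ∷ r)))) (+-identityˡ rest) ⟩
      rest
        ≡⟨ ∑-splits-[]ˡ r (λ V₁ V₂ → irr t A U (b ∷ V₁) * g V₂) (λ c V₁ V₂ → *-zeroˡ (g V₂)) ⟩
      irr t A U [ b ] * g r
        ≡⟨ cong (_* g r) (coeff-▷[] U [ b ] A) ⟩
      ⟨ U ▷ [ b ] ∣ A ⟩ * g r ∎
      where rest = ∑[ V₁ , V₂ ← splits r ] irr t A U (b ∷ V₁) * g V₂

    ◁[<_] : ℕ → Word → Coef2
    ◁[< zero  ] A U V = 0ℚ
    ◁[< suc N ] A U V = ◁[< N ] A U V + ◁[ N ] A U V

    ◁[<]-vanish : ∀ N A U V → N ≤ length V → ◁[< N ] A U V ≡ 0ℚ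
    ◁[<]-vanish zero    A U V _     = refl
    ◁[<]-vanish (suc N) A U V N<|V| =
      trans (cong₂ _+_ (◁[<]-vanish N A U V (ℕ.<⇒≤ N<|V|)) (◁-≢ A U V (ℕ.>⇒≢ N<|V|)))
            (+-identityˡ 0ℚ)

    ◁[<]-complete : ∀ N A U V → length V < N → ◁[< N ] A U V ≡ ◁ A U V
    ◁[<]-complete (suc N) A U V (s≤s |V|≤N) with ℕ.m≤n⇒m<n∨m≡n |V|≤N
    ... | inj₁ |V|<N = trans (cong₂ _+_ (◁[<]-complete N A U V |V|<N) (◁-≢ A U V (ℕ.<⇒≢ |V|<N)))
                             (+-identityʳ _)
    ... | inj₂ |V|≡N = trans (cong₂ _+_ (◁[<]-vanish N A U V (ℕ.≤-reflexive (sym |V|≡N)))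
                                        (◁-≡ A U V |V|≡N))
                             (+-identityˡ _)

    irrFold : Coef2 → List Word → Coef2
    irrFold = foldl (λ acc Aᵢ → acc ⧢• irr t Aᵢ)

    ΔGL-coeff≡tensor1⋆◁ : ∀ A U V → ΔGL-coeff t A U V ≡ tensor1⋆ ◁ A U V
    ΔGL-coeff≡tensor1⋆◁ A U V = begin
      coeff ((mono ⋆ ▷[ V ]) U) A
        ≡⟨ coeff-⋆ mono ▷[ V ] U A ⟩
      ∑[ U₁ , U₂ ← desh U ] ∑[ A₁ , A₂ ← splits A ] coeff (mono U₁) A₁ * coeff (▷[ V ] U₂) A₂
        ≡⟨ ∑₂-cong (desh U) (λ U₁ U₂ → ∑₂-cong (splits A) (λ A₁ A₂ →
             cong₂ _*_ (coeff-mono U₁ A₁) (coeff-▷[] U₂ V A₂))) ⟩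
      ∑[ U₁ , U₂ ← desh U ] ∑[ A₁ , A₂ ← splits A ] δ U₁ A₁ * ⟨ U₂ ▷ V ∣ A₂ ⟩
        ≡⟨ ∑₂-comm (desh U) (splits A) _ ⟩
      tensor1⋆ ◁ A U V ∎

    module PostLie (pl : PostLieExt t) where
      open PostLieExt pl

      ▷-++ : ∀ q B C W → ⟨ q ▷ B ++ C ∣ W ⟩ ≡
             ∑[ q₁ , q₂ ← desh q ] ∑[ W₁ , W₂ ← splits W ] ⟨ q₁ ▷ B ∣ W₁ ⟩ * ⟨ q₂ ▷ C ∣ W₂ ⟩
      ▷-++ q B C W = begin
        ⟨ q ▷ B ++ C ∣ W ⟩
          ≡⟨ coeff-▷[] q (B ++ C) W ⟨
        coeff (▷[ B ++ C ] q) W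
          ≡⟨ ext-right (mono q) (mono B) (mono C) W ⟩
        coeff ((▷[ B ] ⋆ ▷[ C ]) q) W
          ≡⟨ coeff-⋆ ▷[ B ] ▷[ C ] q W ⟩
        ∑[ q₁ , q₂ ← desh q ] ∑[ W₁ , W₂ ← splits W ] coeff (▷[ B ] q₁) W₁ * coeff (▷[ C ] q₂) W₂
          ≡⟨ ∑₂-cong (desh q) (λ q₁ q₂ → ∑₂-cong (splits W) (λ W₁ W₂ →
               cong₂ _*_ (coeff-▷[] q₁ B W₁) (coeff-▷[] q₂ C W₂))) ⟩
        ∑[ q₁ , q₂ ← desh q ] ∑[ W₁ , W₂ ← splits W ] ⟨ q₁ ▷ B ∣ W₁ ⟩ * ⟨ q₂ ▷ C ∣ W₂ ⟩ ∎

      -- Expand a w ▷ 𝟏 by ▷-++; the deshuffle factor without a is no longer than w, so by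
      -- induction it contributes its counit, and each of the two halves of the sum collapses
      -- to ⟨ a w ▷ 𝟏 ∣ W ⟩. Thus this coefficient equals its own double.
      ▷-[]-≤ : ∀ n u → length u ≤ n → ∀ W → ⟨ u ▷ [] ∣ W ⟩ ≡ δ [] u * δ [] W
      ▷-[]-≤ _ [] _ W = begin
        ⟨ [] ▷ [] ∣ W ⟩         ≡⟨ coeff-▷[] [] [] W ⟨
        coeff (ext t 𝟏 𝟏) W     ≡⟨ ext-unit-l 𝟏 W ⟩
        coeff 𝟏 W               ≡⟨ coeff-mono [] W ⟩
        δ [] W                  ≡⟨ *-identityˡ (δ [] W) ⟨
        1ℚ * δ [] W             ∎
      ▷-[]-≤ (suc n) (a ∷ w) (s≤s |w|≤n) W =
        trans (identityˡ-unique x x (sym x≡x+x)) (sym (*-zeroˡ (δ [] W)))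
        where
        x = ⟨ a ∷ w ▷ [] ∣ W ⟩

        IH : ∀ y → length y ≤ length w → ∀ W′ → ⟨ y ▷ [] ∣ W′ ⟩ ≡ δ [] y * δ [] W′
        IH y |y|≤|w| = ▷-[]-≤ n y (ℕ.≤-trans |y|≤|w| |w|≤n)

        a-in-left : ∀ u y → length u ≤ length w → length y ≤ length w →
          ∑[ W₁ , W₂ ← splits W ] ⟨ a ∷ u ▷ [] ∣ W₁ ⟩ * ⟨ y ▷ [] ∣ W₂ ⟩ ≡ ⟨ a ∷ u ▷ [] ∣ W ⟩ * δ [] y
        a-in-left u y _ |y|≤ = begin
          ∑[ W₁ , W₂ ← splits W ] ⟨ a ∷ u ▷ [] ∣ W₁ ⟩ * ⟨ y ▷ [] ∣ W₂ ⟩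
            ≡⟨ ∑₂-cong (splits W) (λ W₁ W₂ →
                 trans (cong (⟨ a ∷ u ▷ [] ∣ W₁ ⟩ *_) (IH y |y|≤ W₂))
                       (sym (*-assoc ⟨ a ∷ u ▷ [] ∣ W₁ ⟩ (δ [] y) (δ [] W₂)))) ⟩
          ∑[ W₁ , W₂ ← splits W ] ⟨ a ∷ u ▷ [] ∣ W₁ ⟩ * δ [] y * δ [] W₂
            ≡⟨ ∑-splits-counitʳ W (λ W₁ → ⟨ a ∷ u ▷ [] ∣ W₁ ⟩ * δ [] y) ⟩
          ⟨ a ∷ u ▷ [] ∣ W ⟩ * δ [] y ∎

        a-in-right : ∀ y u → length y ≤ length w → length u ≤ length w →
          ∑[ W₁ , W₂ ← splits W ] ⟨ y ▷ [] ∣ W₁ ⟩ * ⟨ a ∷ u ▷ [] ∣ W₂ ⟩ ≡ δ [] y * ⟨ a ∷ u ▷ [] ∣ W ⟩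
        a-in-right y u |y|≤ _ = begin
          ∑[ W₁ , W₂ ← splits W ] ⟨ y ▷ [] ∣ W₁ ⟩ * ⟨ a ∷ u ▷ [] ∣ W₂ ⟩
            ≡⟨ ∑₂-cong (splits W) (λ W₁ W₂ → begin
                 ⟨ y ▷ [] ∣ W₁ ⟩ * ⟨ a ∷ u ▷ [] ∣ W₂ ⟩     ≡⟨ cong (_* _) (IH y |y|≤ W₁) ⟩
                 δ [] y * δ [] W₁ * ⟨ a ∷ u ▷ [] ∣ W₂ ⟩    ≡⟨ *-assoc (δ [] y) (δ [] W₁) _ ⟩
                 δ [] y * (δ [] W₁ * ⟨ a ∷ u ▷ [] ∣ W₂ ⟩)  ≡⟨ *-left-comm (δ [] y) (δ [] W₁) _ ⟩
                 δ [] W₁ * (δ [] y * ⟨ a ∷ u ▷ [] ∣ W₂ ⟩)  ∎) ⟩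
          ∑[ W₁ , W₂ ← splits W ] δ [] W₁ * (δ [] y * ⟨ a ∷ u ▷ [] ∣ W₂ ⟩)
            ≡⟨ ∑-splits-counitˡ W (λ W₂ → δ [] y * ⟨ a ∷ u ▷ [] ∣ W₂ ⟩) ⟩
          δ [] y * ⟨ a ∷ u ▷ [] ∣ W ⟩ ∎

        x≡x+x : x ≡ x + x
        x≡x+x = begin
          x ≡⟨ ▷-++ (a ∷ w) [] [] W ⟩
          ∑[ u₁ , u₂ ← desh (a ∷ w) ] ∑[ W₁ , W₂ ← splits W ] ⟨ u₁ ▷ [] ∣ W₁ ⟩ * ⟨ u₂ ▷ [] ∣ W₂ ⟩
            ≡⟨ ∑-desh-∷ a w _ ⟩
          ∑[ u , y ← desh w ] ∑[ W₁ , W₂ ← splits W ] ⟨ a ∷ u ▷ [] ∣ W₁ ⟩ * ⟨ y ▷ [] ∣ W₂ ⟩ +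
          ∑[ y , u ← desh w ] ∑[ W₁ , W₂ ← splits W ] ⟨ y ▷ [] ∣ W₁ ⟩ * ⟨ a ∷ u ▷ [] ∣ W₂ ⟩
            ≡⟨ cong₂ _+_ (∑-desh-cong-≤ w a-in-left) (∑-desh-cong-≤ w a-in-right) ⟩
          ∑[ u , y ← desh w ] ⟨ a ∷ u ▷ [] ∣ W ⟩ * δ [] y + ∑[ y , u ← desh w ] δ [] y * ⟨ a ∷ u ▷ [] ∣ W ⟩
            ≡⟨ cong₂ _+_ (∑-desh-counitʳ w (λ u → ⟨ a ∷ u ▷ [] ∣ W ⟩))
                         (∑-desh-counitˡ w (λ u → ⟨ a ∷ u ▷ [] ∣ W ⟩)) ⟩
          x + x ∎

      ▷-[] : ∀ u W → ⟨ u ▷ [] ∣ W ⟩ ≡ δ [] u * δ [] W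
      ▷-[] u = ▷-[]-≤ (length u) u ℕ.≤-refl

      -- Dual to A ▷ bC = (A₍₁₎ ▷ b)(A₍₂₎ ▷ C): the part of ◁ with right factors of length
      -- m + 2 is the deconcatenation convolution of ◁^irr with the part of length m + 1.
      ◁-step : ∀ m A U V →
        ∑[ A₁ , A₂ ← splits A ] (irr t A₁ ⧢• ◁[ suc m ] A₂) U V ≡ ◁[ suc (suc m) ] A U V
      ◁-step m A U [] =
        ∑₂-zero (splits A) (λ A₁ A₂ → trans (⧢•-expand (irr t A₁) (◁[ suc m ] A₂) U [])
          (∑₂-zero (desh U) (λ U₁ U₂ →
            trans (+-identityʳ (0ℚ * ◁[ suc m ] A₂ U₂ [])) (*-zeroˡ (◁[ suc m ] A₂ U₂ [])))))
      ◁-step m A U (b ∷ r) = begin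
        ∑[ A₁ , A₂ ← splits A ] (irr t A₁ ⧢• ◁[ suc m ] A₂) U (b ∷ r)
          ≡⟨ ∑₂-cong (splits A) (λ A₁ A₂ → trans (⧢•-expand (irr t A₁) (◁[ suc m ] A₂) U (b ∷ r))
               (∑₂-cong (desh U) (λ U₁ U₂ → ∑-splits-irr A₁ U₁ b r (◁[ suc m ] A₂ U₂)))) ⟩
        ∑[ A₁ , A₂ ← splits A ] ∑[ U₁ , U₂ ← desh U ] ⟨ U₁ ▷ [ b ] ∣ A₁ ⟩ * ◁[ suc m ] A₂ U₂ r
          ≡⟨ by-length (length r ℕ.≟ suc m) ⟩
        ◁[ suc (suc m) ] A U (b ∷ r) ∎
        where
        by-length : Dec (length r ≡ suc m) →
          ∑[ A₁ , A₂ ← splits A ] ∑[ U₁ , U₂ ← desh U ] ⟨ U₁ ▷ [ b ] ∣ A₁ ⟩ * ◁[ suc m ] A₂ U₂ r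
          ≡ ◁[ suc (suc m) ] A U (b ∷ r)
        by-length (yes |r|≡) = begin
          ∑[ A₁ , A₂ ← splits A ] ∑[ U₁ , U₂ ← desh U ] ⟨ U₁ ▷ [ b ] ∣ A₁ ⟩ * ◁[ suc m ] A₂ U₂ r
            ≡⟨ ∑₂-cong (splits A) (λ A₁ A₂ → ∑₂-cong (desh U) (λ U₁ U₂ →
                 cong (⟨ U₁ ▷ [ b ] ∣ A₁ ⟩ *_) (◁-≡ A₂ U₂ r |r|≡))) ⟩
          ∑[ A₁ , A₂ ← splits A ] ∑[ U₁ , U₂ ← desh U ] ⟨ U₁ ▷ [ b ] ∣ A₁ ⟩ * ⟨ U₂ ▷ r ∣ A₂ ⟩
            ≡⟨ ∑₂-comm (splits A) (desh U) _ ⟩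
          ∑[ U₁ , U₂ ← desh U ] ∑[ A₁ , A₂ ← splits A ] ⟨ U₁ ▷ [ b ] ∣ A₁ ⟩ * ⟨ U₂ ▷ r ∣ A₂ ⟩
            ≡⟨ ▷-++ U [ b ] r A ⟨
          ⟨ U ▷ b ∷ r ∣ A ⟩
            ≡⟨ ◁-≡ A U (b ∷ r) (cong suc |r|≡) ⟨
          ◁[ suc (suc m) ] A U (b ∷ r) ∎
        by-length (no |r|≢) = begin
          ∑[ A₁ , A₂ ← splits A ] ∑[ U₁ , U₂ ← desh U ] ⟨ U₁ ▷ [ b ] ∣ A₁ ⟩ * ◁[ suc m ] A₂ U₂ r
            ≡⟨ ∑₂-zero (splits A) (λ A₁ A₂ → ∑₂-zero (desh U) (λ U₁ U₂ →
                 trans (cong (⟨ U₁ ▷ [ b ] ∣ A₁ ⟩ *_) (◁-≢ A₂ U₂ r |r|≢)) (*-zeroʳ ⟨ U₁ ▷ [ b ] ∣ A₁ ⟩))) ⟩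
          0ℚ
            ≡⟨ ◁-≢ A U (b ∷ r) (|r|≢ ∘ ℕ.suc-injective) ⟨
          ◁[ suc (suc m) ] A U (b ∷ r) ∎

      ∑-irrFold : ∀ m F A U V →
        ∑[ As ← facts (suc m) A ] irrFold F As U V ≡ (F ⧢• ◁[ suc m ] A) U V
      ∑-irrFold zero F A U V =
        trans (+-identityʳ ((F ⧢• irr t A) U V)) (⧢•-congʳ F (irr≡◁[1] A) U V)
      ∑-irrFold (suc m) F A U V = begin
        ∑[ As ← facts (suc (suc m)) A ] irrFold F As U V
          ≡⟨ ∑-facts-suc m A (λ As → irrFold F As U V) ⟩
        ∑[ A₁ , A₂ ← splits A ] ∑[ As ← facts (suc m) A₂ ] irrFold (F ⧢• irr t A₁) As U V
          ≡⟨ ∑₂-cong (splits A) (λ A₁ A₂ → ∑-irrFold m (F ⧢• irr t A₁) A₂ U V) ⟩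
        ∑[ A₁ , A₂ ← splits A ] ((F ⧢• irr t A₁) ⧢• ◁[ suc m ] A₂) U V
          ≡⟨ ∑₂-cong (splits A) (λ A₁ A₂ → ⧢•-assoc F (irr t A₁) (◁[ suc m ] A₂) U V) ⟩
        ∑[ A₁ , A₂ ← splits A ] (F ⧢• (irr t A₁ ⧢• ◁[ suc m ] A₂)) U V
          ≡⟨ ⧢•-∑ʳ (splits A) F (uncurry λ A₁ A₂ → irr t A₁ ⧢• ◁[ suc m ] A₂) U V ⟩
        (F ⧢• (λ U′ V′ → ∑[ A₁ , A₂ ← splits A ] (irr t A₁ ⧢• ◁[ suc m ] A₂) U′ V′)) U V
          ≡⟨ ⧢•-congʳ F (◁-step m A) U V ⟩
        (F ⧢• ◁[ suc (suc m) ] A) U V ∎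

      tensor1⋆-◁[0] : ∀ A U V → tensor1⋆ ◁[ 0 ] A U V ≡ tensor1 A U V
      tensor1⋆-◁[0] A U [] = begin
        ∑[ A₁ , A₂ ← splits A ] ∑[ U₁ , U₂ ← desh U ] δ U₁ A₁ * ⟨ U₂ ▷ [] ∣ A₂ ⟩
          ≡⟨ ∑₂-cong (splits A) (λ A₁ A₂ → ∑₂-cong (desh U) (λ U₁ U₂ → begin
               δ U₁ A₁ * ⟨ U₂ ▷ [] ∣ A₂ ⟩          ≡⟨ cong (δ U₁ A₁ *_) (▷-[] U₂ A₂) ⟩
               δ U₁ A₁ * (δ [] U₂ * δ [] A₂)       ≡⟨ *-assoc (δ U₁ A₁) (δ [] U₂) (δ [] A₂) ⟨
               δ U₁ A₁ * δ [] U₂ * δ [] A₂         ∎)) ⟩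
        ∑[ A₁ , A₂ ← splits A ] ∑[ U₁ , U₂ ← desh U ] δ U₁ A₁ * δ [] U₂ * δ [] A₂
          ≡⟨ ∑₂-cong (splits A) (λ A₁ A₂ → *-distribʳ-∑ (δ [] A₂) (desh U) _) ⟨
        ∑[ A₁ , A₂ ← splits A ] (∑[ U₁ , U₂ ← desh U ] δ U₁ A₁ * δ [] U₂) * δ [] A₂
          ≡⟨ ∑₂-cong (splits A) (λ A₁ A₂ → cong (_* δ [] A₂) (∑-desh-counitʳ U (λ U₁ → δ U₁ A₁))) ⟩
        ∑[ A₁ , A₂ ← splits A ] δ U A₁ * δ [] A₂
          ≡⟨ ∑-splits-counitʳ A (δ U) ⟩
        δ U A ∎
      tensor1⋆-◁[0] A U (b ∷ V) = begin
        tensor1⋆ ◁[ 0 ] A U (b ∷ V)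
          ≡⟨ ∑₂-zero (splits A) (λ A₁ A₂ → ∑₂-zero (desh U) (λ U₁ U₂ → *-zeroʳ (δ U₁ A₁))) ⟩
        0ℚ
          ≡⟨ *-zeroʳ (δ U A) ⟨
        δ U A * δ [] (b ∷ V)
          ≡⟨ tensor1-δ A U (b ∷ V) ⟨
        tensor1 A U (b ∷ V) ∎

      term≡tensor1⋆◁ : ∀ m A U V → term t (suc m) A U V ≡ tensor1⋆ ◁[ m ] A U V
      term≡tensor1⋆◁ zero A U V =
        trans (+-identityʳ (tensor1 A U V)) (sym (tensor1⋆-◁[0] A U V))
      term≡tensor1⋆◁ (suc m) A U V = begin
        term t (suc (suc m)) A U V
          ≡⟨ ∑-facts-suc m A (λ As → factorTerm t As U V) ⟩
        ∑[ A₁ , A₂ ← splits A ] ∑[ As ← facts (suc m) A₂ ] irrFold (tensor1 A₁) As U V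
          ≡⟨ ∑₂-cong (splits A) (λ A₁ A₂ → ∑-irrFold m (tensor1 A₁) A₂ U V) ⟩
        ∑[ A₁ , A₂ ← splits A ] (tensor1 A₁ ⧢• ◁[ suc m ] A₂) U V
          ≡⟨ ∑₂-cong (splits A) (λ A₁ A₂ → tensor1-⧢• A₁ (◁[ suc m ] A₂) U V) ⟩
        tensor1⋆ ◁[ suc m ] A U V ∎

      partialRHS≡tensor1⋆◁[<] : ∀ N A U V → partialRHS t N A U V ≡ tensor1⋆ ◁[< N ] A U V
      partialRHS≡tensor1⋆◁[<] zero A U V =
        sym (∑₂-zero (splits A) (λ A₁ A₂ → ∑₂-zero (desh U) (λ U₁ U₂ → *-zeroʳ (δ U₁ A₁))))
      partialRHS≡tensor1⋆◁[<] (suc N) A U V =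
        trans (cong₂ _+_ (partialRHS≡tensor1⋆◁[<] N A U V) (term≡tensor1⋆◁ N A U V))
              (tensor1⋆-+ ◁[< N ] ◁[ N ] A U V)

theorem2p4 : (𝔸 : Alphabet) → let open Over 𝔸 in
    (t : Prod) → PostLieExt t → (A U V : Word) →
    Σ ℕ (λ N₀ → ∀ N → N₀ ≤ N → partialRHS t N A U V ≡ ΔGL-coeff t A U V)
theorem2p4 𝔸 t pl A U V = suc (length V) , λ N |V|<N → begin
  partialRHS t N A U V
    ≡⟨ partialRHS≡tensor1⋆◁[<] N A U V ⟩
  tensor1⋆ ◁[< N ] A U V
    ≡⟨ tensor1⋆-cong ◁[< N ] ◁ A U V (λ A′ U′ → ◁[<]-complete N A′ U′ V |V|<N) ⟩
  tensor1⋆ ◁ A U V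
    ≡⟨ ΔGL-coeff≡tensor1⋆◁ A U V ⟨
  ΔGL-coeff t A U V ∎
  where
  open Over 𝔸
  open Coefficients 𝔸
  open Cotriangle t
  open PostLie pl
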